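{- Let $q\ge3$, let $\alpha=(1,3)$ and $\alpha^{ -1}=(3,1)$, where $\alpha^j$ denotes $j$ concatenated copies. With a suitable choice of the middle sign of $\mathbf f(\tfrac1q)$: - if $q$ is odd, then $C_{\frac1q}=4,\alpha^{\frac{q-3}2},2,1,(\alpha^{ -1})^{\frac{q-3}2},4$; - if $q$ is even, then $C_{\frac1q}=4,\alpha^{\frac{q-4}2},1,2,3,1,(\alpha^{ -1})^{\frac{q-4}2},4$.
   Context: Lattice. Use the lattice of unit segments on the lines $y=c$, $x=c$, $y=-x+c$ ($c\in\mathbb Z$). Sign sequence $\mathbf f(\tfrac pq)$. For coprime positive $p\le q$, let $\gamma$ be the segment from $(0,0)$ to $(q,p)$, oriented away from the origin, crossing lattice segments $\sigma_1,\ldots,\sigma_N$ ($N=2(p+q)-3$) in order at points $s_i$. Then $\mathbf f(\tfrac pq)=(f_0,\ldots,f_{2N})$ is defined as follows. - $f_0=-$ and $f_{2N}=+$. - $f_{2i-1}=-$ if $s_i$ is closer to the endpoint of $\sigma_i$ to the right of $\gamma$, and $+$ if closer to the left one. The middle crossing is at a midpoint and may receive either sign. - $f_{2i}=-$ if the common endpoint of $\sigma_i,\sigma_{i+1}$ is to the right of $\gamma$, and $+$ otherwise. $C_{\frac pq}$ is the sequence of lengths of maximal blocks of consecutive equal signs in $\mathbf f(\tfrac pq)$. The paper fixes a convention for the middle sign; the two choices give sequences that are reverses of each other near the middle. -}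

module Defs where

open import Data.Nat using (ℕ; zero; suc; _+_; _*_; _∸_; _<ᵇ_; _≡ᵇ_; _≤?_)
open import Data.Nat.DivMod using (_/_)
open import Data.Bool using (Bool; true; false; if_then_else_; _∧_)
open import Data.Product using (_×_; _,_; proj₁; proj₂)
open import Data.List using (List; []; _∷_; _++_; map; upTo; merge)
open import Data.Sign as Sgn using (Sign)
open import Data.Sign.Properties using (_≟_)
open import Data.Integer as ℤ using (ℤ)
open import Relation.Nullary using (does)

_div_ : ℕ → ℕ → ℕ
m div zero    = zero
m div (suc n) = m / suc n

-- Lattice points (all relevant ones lie in the first quadrant).
Point : Set
Point = ℕ × ℕ

-- A crossing of γ with a lattice unit segment σ.
-- key : the crossing point is γ(t) = t·(q,p) with t = key / (p·q·(p+q)).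
-- end₁, end₂ : the two endpoints of the lattice segment σ.
record Crossing : Set where
  constructor crossing
  field
    key  : ℕ
    end₁ : Point
    end₂ : Point
open Crossing public

samePoint : Point → Point → Bool
samePoint (a , b) (c , d) = (a ≡ᵇ c) ∧ (b ≡ᵇ d)

module _ (p q : ℕ) where

  -- crossing with the vertical line x = c  (t = c/q)
  vertical : ℕ → Crossing
  vertical c = crossing (c * p * (p + q)) (c , (c * p) div q) (c , suc ((c * p) div q))

  -- crossing with the horizontal line y = c  (t = c/p)
  horizontal : ℕ → Crossing
  horizontal c = crossing (c * q * (p + q)) ((c * q) div p , c) (suc ((c * q) div p) , c)

  -- crossing with the anti-diagonal line x + y = c  (t = c/(p+q))
  diagonal : ℕ → Crossing
  diagonal c = crossing (c * p * q)
                 ((c * q) div (p + q) , c ∸ (c * q) div (p + q))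
                 (suc ((c * q) div (p + q)) , c ∸ suc ((c * q) div (p + q)))

  crossings : List Crossing
  crossings =
    merge (λ x y → key x ≤? key y)
      (map (λ c → vertical (suc c)) (upTo (q ∸ 1)))
      (merge (λ x y → key x ≤? key y)
        (map (λ c → horizontal (suc c)) (upTo (p ∸ 1)))
        (map (λ c → diagonal (suc c)) (upTo (p + q ∸ 1))))

  -- a lattice point (x,y) is strictly to the right of γ (oriented from
  -- (0,0) to (q,p)) iff the cross product q·y − p·x is negative
  rightOf : Point → Bool
  rightOf (x , y) = (q * y) <ᵇ (p * x)

  sideSign : Point → Sign
  sideSign P = if rightOf P then Sgn.- else Sgn.+

  -- squared Euclidean distance between the crossing point s and the
  -- endpoint P, both scaled by L = p·q·(p+q)  (so everything is integral)
  L : ℕ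
  L = p * q * (p + q)

  dist² : Crossing → Point → ℤ
  dist² σ (x , y) =
    let dx = ℤ.+ (key σ * q) ℤ.- ℤ.+ (L * x)
        dy = ℤ.+ (key σ * p) ℤ.- ℤ.+ (L * y)
    in dx ℤ.* dx ℤ.+ dy ℤ.* dy

  -- sign at odd positions: sign of the side of the nearer endpoint;
  -- if s is equidistant (the middle crossing), the chosen sign m is used
  oddSign : Sign → Crossing → Sign
  oddSign m σ with does (dist² σ (end₁ σ) ℤ.<? dist² σ (end₂ σ))
                 | does (dist² σ (end₂ σ) ℤ.<? dist² σ (end₁ σ))
  ... | true  | _     = sideSign (end₁ σ)
  ... | false | true  = sideSign (end₂ σ)
  ... | false | false = m

  commonEnd : Crossing → Crossing → Point
  commonEnd σ τ =
    if samePoint (end₁ σ) (end₁ τ) ∨' samePoint (end₁ σ) (end₂ τ)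
    then end₁ σ else end₂ σ
    where
      _∨'_ : Bool → Bool → Bool
      true ∨' _ = true
      false ∨' b = b

  evenSign : Crossing → Crossing → Sign
  evenSign σ τ = sideSign (commonEnd σ τ)

  body : Sign → List Crossing → List Sign
  body m []            = []
  body m (σ ∷ [])      = oddSign m σ ∷ []
  body m (σ ∷ τ ∷ rest) = oddSign m σ ∷ evenSign σ τ ∷ body m (τ ∷ rest)

  signSeq : Sign → List Sign
  signSeq m = Sgn.- ∷ (body m crossings ++ (Sgn.+ ∷ []))

runsFrom : Sign → ℕ → List Sign → List ℕ
runsFrom s n []       = n ∷ []
runsFrom s n (t ∷ ts) = if does (s ≟ t) then runsFrom s (suc n) ts
                                         else n ∷ runsFrom t 1 ts

runs : List Sign → List ℕ
runs []       = []
runs (s ∷ ts) = runsFrom s 1 ts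

C : ℕ → ℕ → Sign → List ℕ
C p q m = runs (signSeq p q m)

-- For p = 1 the segment γ from (0,0) to (q,1) crosses, in this order, the diagonals
-- x + y = c and verticals x = c for c = 1, …, q − 1, and finally the diagonal x + y = q.
-- The corner shared by the c-th diagonal and the c-th vertical crossing is (c,0), below γ,
-- and the next corner is (c,1), above γ. The vertical crossing is nearer to (c,0) iff 2c < q,
-- the diagonal one nearer to (c,0) iff 2c < q + 1; the two ties are the middle crossing,
-- which receives the sign +. So each c contributes the block − − − + if 2c < q, − − + +
-- if 2c = q and + − + + if 2c > q, and the run lengths are read off the concatenation.

module Submission where

open import Data.Bool using (true; false)
open import Data.Empty using (⊥-elim)
open import Data.Integer as ℤ using (ℤ; +_; -[1+_])
import Data.Integer.Properties as ℤ
open import Data.List using (List; []; _∷_; _++_; concat; replicate; map; iterate; applyUpTo; upTo; merge)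
open import Data.List.Properties using (map-applyUpTo; map-∘; ++-assoc)
open import Data.Nat
open import Data.Nat.DivMod using (_/_; _%_; m<n⇒m/n≡0; +-distrib-/-∣ʳ; /-congˡ; m*n/n≡m; [m+kn]%n≡m%n)
open import Data.Nat.Divisibility using (n∣m*n)
open import Data.Nat.Properties
open import Data.Nat.Tactic.RingSolver using (solve-∀)
open import Data.Product using (_×_; _,_; ∃)
open import Data.Sign as Sign using (Sign)
open import Data.Sum using (_⊎_; inj₁; inj₂)
open import Relation.Binary.PropositionalEquality
open import Relation.Nullary using (contradiction)
open import Relation.Nullary.Decidable using (dec-true; dec-false)

open import Defs

i*i≡+∣i∣*∣i∣ : ∀ i → i ℤ.* i ≡ + (ℤ.∣ i ∣ * ℤ.∣ i ∣)
i*i≡+∣i∣*∣i∣ (+ n)    = ℤ.+◃n≡+n (n * n)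
i*i≡+∣i∣*∣i∣ -[1+ n ] = ℤ.+◃n≡+n (suc n * suc n)

∣+m-+n∣≡∣m-n∣ : ∀ m n → ℤ.∣ + m ℤ.- + n ∣ ≡ ∣ m - n ∣
∣+m-+n∣≡∣m-n∣ m n rewrite ℤ.m-n≡m⊖n m n with ≤-total n m
... | inj₁ n≤m rewrite ℤ.⊖-≥ n≤m = sym (m≤n⇒∣n-m∣≡n∸m n≤m)
... | inj₂ m≤n rewrite ℤ.⊖-≤ m≤n = trans (ℤ.∣-i∣≡∣i∣ (+ (n ∸ m))) (sym (m≤n⇒∣m-n∣≡n∸m m≤n))

m≡n+o⇒∣m-n∣≡o : ∀ m n {o} → m ≡ n + o → ∣ m - n ∣ ≡ o
m≡n+o⇒∣m-n∣≡o _ n {o} refl = trans (∣-∣-comm (n + o) n) (∣m-m+n∣≡n n o)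

m+o≡n⇒∣m-n∣≡o : ∀ m n {o} → m + o ≡ n → ∣ m - n ∣ ≡ o
m+o≡n⇒∣m-n∣≡o m _ {o} refl = ∣m-m+n∣≡n m o

n≡ᵇn : ∀ n → (n ≡ᵇ n) ≡ true
n≡ᵇn zero    = refl
n≡ᵇn (suc n) = n≡ᵇn n

n≢ᵇ1+n : ∀ n → (n ≡ᵇ suc n) ≡ false
n≢ᵇ1+n zero    = refl
n≢ᵇ1+n (suc n) = n≢ᵇ1+n n

[1+a]*[1+a+r]≡1+r+a*[2+a+r] : ∀ a r → suc a * suc (a + r) ≡ suc r + a * suc (suc (a + r))
[1+a]*[1+a+r]≡1+r+a*[2+a+r] = solve-∀

[1+a]*[1+a+r]/[2+a+r]≡a : ∀ a r → (suc a * suc (a + r)) / suc (suc (a + r)) ≡ a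
[1+a]*[1+a+r]/[2+a+r]≡a a r = begin
  (suc a * suc (a + r)) / suc (suc (a + r))             ≡⟨ /-congˡ {o = suc (suc (a + r))} ([1+a]*[1+a+r]≡1+r+a*[2+a+r] a r) ⟩
  (suc r + a * suc (suc (a + r))) / suc (suc (a + r))   ≡⟨ +-distrib-/-∣ʳ (suc r) (n∣m*n a) ⟩
  suc r / suc (suc (a + r)) + a * suc (suc (a + r)) / suc (suc (a + r))
    ≡⟨ cong₂ _+_ (m<n⇒m/n≡0 (s≤s (s≤s (m≤n+m r a)))) (m*n/n≡m a (suc (suc (a + r)))) ⟩
  a                                                     ∎
  where open ≡-Reasoning

applyUpTo-iterate : ∀ (f : ℕ → ℕ) c k → (∀ i → f i ≡ c + i) → applyUpTo f k ≡ iterate suc c k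
applyUpTo-iterate f c zero    _ = refl
applyUpTo-iterate f c (suc k) h = cong₂ _∷_ (trans (h 0) (+-identityʳ c))
  (applyUpTo-iterate (λ i → f (suc i)) (suc c) k (λ i → trans (h (suc i)) (+-suc c i)))

map-shift-upTo : ∀ {A : Set} (f : ℕ → A) k → map (λ i → f (suc i)) (upTo k) ≡ map f (iterate suc 1 k)
map-shift-upTo f k = begin
  map (λ i → f (suc i)) (upTo k)   ≡⟨ map-∘ (upTo k) ⟩
  map f (map suc (upTo k))         ≡⟨ cong (map f) (map-applyUpTo (λ i → i) suc k) ⟩
  map f (applyUpTo suc k)          ≡⟨ cong (map f) (applyUpTo-iterate suc 1 k (λ _ → refl)) ⟩
  map f (iterate suc 1 k)          ∎
  where open ≡-Reasoning

even⊎odd : ∀ n → (∃ λ j → n ≡ j * 2) ⊎ (∃ λ j → n ≡ 1 + j * 2)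
even⊎odd zero = inj₁ (0 , refl)
even⊎odd (suc n) with even⊎odd n
... | inj₁ (j , n≡2j)   = inj₂ (j , cong suc n≡2j)
... | inj₂ (j , n≡1+2j) = inj₁ (suc j , cong suc n≡1+2j)

module _ (p q : ℕ) where

  dist²≡ : ∀ σ x y {u v} → ∣ key σ * q - L p q * x ∣ ≡ u → ∣ key σ * p - L p q * y ∣ ≡ v →
           dist² p q σ (x , y) ≡ + (u * u + v * v)
  dist²≡ σ x y refl refl = cong₂ ℤ._+_ (square (key σ * q) (L p q * x)) (square (key σ * p) (L p q * y))
    where
    square : ∀ m n → (+ m ℤ.- + n) ℤ.* (+ m ℤ.- + n) ≡ + (∣ m - n ∣ * ∣ m - n ∣)
    square m n = trans (i*i≡+∣i∣*∣i∣ (+ m ℤ.- + n)) (cong (λ k → + (k * k)) (∣+m-+n∣≡∣m-n∣ m n))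

  sideSign-right : ∀ {x y} → q * y < p * x → sideSign p q (x , y) ≡ Sign.-
  sideSign-right {x} {y} h with q * y <ᵇ p * x | <⇒<ᵇ h
  ... | true  | _  = refl
  ... | false | ()

  sideSign-left : ∀ {x y} → p * x ≤ q * y → sideSign p q (x , y) ≡ Sign.+
  sideSign-left {x} {y} h with q * y <ᵇ p * x | <ᵇ⇒< (q * y) (p * x)
  ... | false | _   = refl
  ... | true  | lt  = ⊥-elim (<⇒≱ (lt _) h)

  module _ (m : Sign) (σ : Crossing) where

    private
      d₁ d₂ : ℤ
      d₁ = dist² p q σ (end₁ σ)
      d₂ = dist² p q σ (end₂ σ)

    oddSign-nearer₁ : d₁ ℤ.< d₂ → oddSign p q m σ ≡ sideSign p q (end₁ σ)
    oddSign-nearer₁ h rewrite dec-true (d₁ ℤ.<? d₂) h = refl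

    oddSign-nearer₂ : d₂ ℤ.< d₁ → oddSign p q m σ ≡ sideSign p q (end₂ σ)
    oddSign-nearer₂ h rewrite dec-false (d₁ ℤ.<? d₂) (ℤ.<-asym h) | dec-true (d₂ ℤ.<? d₁) h = refl

    oddSign-equidistant : d₁ ≡ d₂ → oddSign p q m σ ≡ m
    oddSign-equidistant h rewrite h | dec-false (d₂ ℤ.<? d₂) (ℤ.<-irrefl refl) = refl

sideSign-bottom : ∀ q {x} → 0 < x → sideSign 1 q (x , 0) ≡ Sign.-
sideSign-bottom q {x} 0<x = sideSign-right 1 q (subst₂ _<_ (sym (*-zeroʳ q)) (sym (*-identityˡ x)) 0<x)

sideSign-top : ∀ q {x} → x ≤ q → sideSign 1 q (x , 1) ≡ Sign.+
sideSign-top q {x} x≤q = sideSign-left 1 q (subst₂ _≤_ (sym (*-identityˡ x)) (sym (*-identityʳ q)) x≤q)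

verticalCrossing : ℕ → ℕ → Crossing
verticalCrossing q c = crossing (c * 1 * (1 + q)) (c , 0) (c , 1)

vertical-ends : ∀ {q c} → c < q → vertical 1 q c ≡ verticalCrossing q c
vertical-ends {suc q} {c} c<q rewrite m<n⇒m/n≡0 (subst (_< suc q) (sym (*-identityʳ c)) c<q) = refl

module _ (c d : ℕ) where

  private
    q : ℕ
    q = c + d
    V : Crossing
    V = verticalCrossing q c

  vertical-dist²-bottom : dist² 1 q V (c , 0) ≡ + (0 * 0 + (c * suc q) * (c * suc q))
  vertical-dist²-bottom = dist²≡ 1 q V c 0 (m≡n+o⇒∣m-n∣≡o (key V * q) (L 1 q * c) (Δx c d))
                                        (m≡n+o⇒∣m-n∣≡o (key V * 1) (L 1 q * 0) (Δy c d))
    where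
    Δx : ∀ c d → c * 1 * (1 + (c + d)) * (c + d) ≡ 1 * (c + d) * (1 + (c + d)) * c + 0
    Δx = solve-∀
    Δy : ∀ c d → c * 1 * (1 + (c + d)) * 1 ≡ 1 * (c + d) * (1 + (c + d)) * 0 + c * suc (c + d)
    Δy = solve-∀

  vertical-dist²-top : dist² 1 q V (c , 1) ≡ + (0 * 0 + (d * suc q) * (d * suc q))
  vertical-dist²-top = dist²≡ 1 q V c 1 (m≡n+o⇒∣m-n∣≡o (key V * q) (L 1 q * c) (Δx c d))
                                     (m+o≡n⇒∣m-n∣≡o (key V * 1) (L 1 q * 1) (Δy c d))
    where
    Δx : ∀ c d → c * 1 * (1 + (c + d)) * (c + d) ≡ 1 * (c + d) * (1 + (c + d)) * c + 0
    Δx = solve-∀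
    Δy : ∀ c d → c * 1 * (1 + (c + d)) * 1 + d * suc (c + d) ≡ 1 * (c + d) * (1 + (c + d)) * 1
    Δy = solve-∀

diagonalCrossing : ℕ → ℕ → Crossing
diagonalCrossing q a = crossing (suc a * 1 * q) (a , 1) (suc a , 0)

diagonal-ends : ∀ a r → diagonal 1 (suc a + r) (suc a) ≡ diagonalCrossing (suc a + r) a
diagonal-ends a r rewrite [1+a]*[1+a+r]/[2+a+r]≡a a r | m+n∸n≡m 1 a | n∸n≡0 a = refl

module _ (a r : ℕ) where

  private
    q : ℕ
    q = suc a + r
    D : Crossing
    D = diagonalCrossing q a

  diagonal-dist²-top : dist² 1 q D (a , 1) ≡ + ((q * suc r) * (q * suc r) + (q * suc r) * (q * suc r))
  diagonal-dist²-top =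
    dist²≡ 1 q D a 1 (m≡n+o⇒∣m-n∣≡o (key D * q) (L 1 q * a) (Δx a r))
                     (m+o≡n⇒∣m-n∣≡o (key D * 1) (L 1 q * 1) (Δy a r))
    where
    Δx : ∀ a r → suc a * 1 * (suc a + r) * (suc a + r) ≡ 1 * (suc a + r) * (1 + (suc a + r)) * a + (suc a + r) * suc r
    Δx = solve-∀
    Δy : ∀ a r → suc a * 1 * (suc a + r) * 1 + (suc a + r) * suc r ≡ 1 * (suc a + r) * (1 + (suc a + r)) * 1
    Δy = solve-∀

  diagonal-dist²-bottom : dist² 1 q D (suc a , 0) ≡ + ((q * suc a) * (q * suc a) + (q * suc a) * (q * suc a))
  diagonal-dist²-bottom =
    dist²≡ 1 q D (suc a) 0 (m+o≡n⇒∣m-n∣≡o (key D * q) (L 1 q * suc a) (Δx a r))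
                           (m≡n+o⇒∣m-n∣≡o (key D * 1) (L 1 q * 0) (Δy a r))
    where
    Δx : ∀ a r → suc a * 1 * (suc a + r) * (suc a + r) + (suc a + r) * suc a ≡ 1 * (suc a + r) * (1 + (suc a + r)) * suc a
    Δx = solve-∀
    Δy : ∀ a r → suc a * 1 * (suc a + r) * 1 ≡ 1 * (suc a + r) * (1 + (suc a + r)) * 0 + (suc a + r) * suc a
    Δy = solve-∀

oddSign-vertical-low : ∀ m {q c} → 0 < c → c + c < q → oddSign 1 q m (vertical 1 q c) ≡ Sign.-
oddSign-vertical-low m {q} {c} 0<c 2c<q with m≤n⇒∃[o]m+o≡n (≤-trans (m≤m+n c c) (<⇒≤ 2c<q))
... | d , refl = begin
  oddSign 1 q m (vertical 1 q c)          ≡⟨ cong (oddSign 1 q m) (vertical-ends (≤-trans (s≤s (m≤m+n c c)) 2c<q)) ⟩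
  oddSign 1 q m (verticalCrossing q c)    ≡⟨ oddSign-nearer₁ 1 q m (verticalCrossing q c) nearer ⟩
  sideSign 1 q (c , 0)                    ≡⟨ sideSign-bottom q 0<c ⟩
  Sign.-                                  ∎
  where
  open ≡-Reasoning
  c<d : c < d
  c<d = +-cancelˡ-< c c d 2c<q
  nearer : dist² 1 q (verticalCrossing q c) (c , 0) ℤ.< dist² 1 q (verticalCrossing q c) (c , 1)
  nearer = subst₂ ℤ._<_ (sym (vertical-dist²-bottom c d)) (sym (vertical-dist²-top c d))
             (ℤ.+<+ (*-mono-< (*-monoˡ-< (suc q) c<d) (*-monoˡ-< (suc q) c<d)))

oddSign-vertical-high : ∀ {q c} → c < q → q ≤ c + c → oddSign 1 q Sign.+ (vertical 1 q c) ≡ Sign.+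
oddSign-vertical-high {q} {c} c<q q≤2c with m≤n⇒∃[o]m+o≡n (<⇒≤ c<q)
... | d , refl = trans (cong (oddSign 1 q Sign.+) (vertical-ends c<q)) (nearer (m≤n⇒m<n∨m≡n d≤c))
  where
  d≤c : d ≤ c
  d≤c = +-cancelˡ-≤ c d c q≤2c
  nearer : d < c ⊎ d ≡ c → oddSign 1 q Sign.+ (verticalCrossing q c) ≡ Sign.+
  nearer (inj₁ d<c) = trans (oddSign-nearer₂ 1 q Sign.+ (verticalCrossing q c)
      (subst₂ ℤ._<_ (sym (vertical-dist²-top c d)) (sym (vertical-dist²-bottom c d))
        (ℤ.+<+ (*-mono-< (*-monoˡ-< (suc q) d<c) (*-monoˡ-< (suc q) d<c)))))
    (sideSign-top q (m≤m+n c d))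
  nearer (inj₂ refl) = oddSign-equidistant 1 q Sign.+ (verticalCrossing q c)
    (trans (vertical-dist²-bottom c c) (sym (vertical-dist²-top c c)))

oddSign-diagonal-low : ∀ m {q c} → 0 < c → c + c ≤ q → oddSign 1 q m (diagonal 1 q c) ≡ Sign.-
oddSign-diagonal-low m {q} {suc a} 0<c 2c≤q with m≤n⇒∃[o]m+o≡n (≤-trans (m≤m+n (suc a) (suc a)) 2c≤q)
... | r , refl = begin
  oddSign 1 q m (diagonal 1 q (suc a))    ≡⟨ cong (oddSign 1 q m) (diagonal-ends a r) ⟩
  oddSign 1 q m (diagonalCrossing q a)    ≡⟨ oddSign-nearer₂ 1 q m (diagonalCrossing q a) nearer ⟩
  sideSign 1 q (suc a , 0)                ≡⟨ sideSign-bottom q z<s ⟩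
  Sign.-                                  ∎
  where
  open ≡-Reasoning
  1+a<1+r : suc a < suc r
  1+a<1+r = s≤s (+-cancelˡ-≤ (suc a) (suc a) r 2c≤q)
  Y<X : q * suc a < q * suc r
  Y<X = *-monoʳ-< q 1+a<1+r
  nearer : dist² 1 q (diagonalCrossing q a) (suc a , 0) ℤ.< dist² 1 q (diagonalCrossing q a) (a , 1)
  nearer = subst₂ ℤ._<_ (sym (diagonal-dist²-bottom a r)) (sym (diagonal-dist²-top a r))
             (ℤ.+<+ (+-mono-< (*-mono-< Y<X Y<X) (*-mono-< Y<X Y<X)))

oddSign-diagonal-high : ∀ {q c} → 0 < c → c ≤ q → q < c + c → oddSign 1 q Sign.+ (diagonal 1 q c) ≡ Sign.+
oddSign-diagonal-high {q} {suc a} 0<c c≤q q<2c with m≤n⇒∃[o]m+o≡n c≤q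
... | r , refl = trans (cong (oddSign 1 q Sign.+) (diagonal-ends a r)) (nearer (m≤n⇒m<n∨m≡n r≤a))
  where
  r≤a : r ≤ a
  r≤a = ≤-pred (+-cancelˡ-< (suc a) r (suc a) q<2c)
  nearer : r < a ⊎ r ≡ a → oddSign 1 q Sign.+ (diagonalCrossing q a) ≡ Sign.+
  nearer (inj₁ r<a) = trans (oddSign-nearer₁ 1 q Sign.+ (diagonalCrossing q a)
      (subst₂ ℤ._<_ (sym (diagonal-dist²-top a r)) (sym (diagonal-dist²-bottom a r))
        (ℤ.+<+ (+-mono-< (*-mono-< X<Y X<Y) (*-mono-< X<Y X<Y)))))
    (sideSign-top q (m≤n⇒m≤1+n (m≤m+n a r)))
    where
    X<Y : q * suc r < q * suc a
    X<Y = *-monoʳ-< q (s≤s r<a)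
  nearer (inj₂ refl) = oddSign-equidistant 1 q Sign.+ (diagonalCrossing q a)
    (trans (diagonal-dist²-top a a) (sym (diagonal-dist²-bottom a a)))

commonEnd-diagonal-vertical : ∀ q a → commonEnd 1 q (diagonalCrossing q a) (verticalCrossing q (suc a)) ≡ (suc a , 0)
commonEnd-diagonal-vertical q a rewrite n≢ᵇ1+n a = refl

commonEnd-vertical-diagonal : ∀ q c → commonEnd 1 q (verticalCrossing q c) (diagonalCrossing q c) ≡ (c , 1)
commonEnd-vertical-diagonal q c rewrite n≡ᵇn c | n≢ᵇ1+n c = refl

evenSign-diagonal-vertical : ∀ {q c} → 0 < c → c < q → evenSign 1 q (diagonal 1 q c) (vertical 1 q c) ≡ Sign.-
evenSign-diagonal-vertical {q} {suc a} _ c<q with m≤n⇒∃[o]m+o≡n (<⇒≤ c<q)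
... | r , refl = begin
  evenSign 1 q (diagonal 1 q (suc a)) (vertical 1 q (suc a))
    ≡⟨ cong₂ (evenSign 1 q) (diagonal-ends a r) (vertical-ends c<q) ⟩
  sideSign 1 q (commonEnd 1 q (diagonalCrossing q a) (verticalCrossing q (suc a)))
    ≡⟨ cong (sideSign 1 q) (commonEnd-diagonal-vertical q a) ⟩
  sideSign 1 q (suc a , 0)
    ≡⟨ sideSign-bottom q z<s ⟩
  Sign.- ∎
  where open ≡-Reasoning

evenSign-vertical-diagonal : ∀ {q c} → c < q → evenSign 1 q (vertical 1 q c) (diagonal 1 q (suc c)) ≡ Sign.+
evenSign-vertical-diagonal {q} {c} c<q with m≤n⇒∃[o]m+o≡n c<q
... | r , refl = begin
  evenSign 1 q (vertical 1 q c) (diagonal 1 q (suc c))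
    ≡⟨ cong₂ (evenSign 1 q) (vertical-ends c<q) (diagonal-ends c r) ⟩
  sideSign 1 q (commonEnd 1 q (verticalCrossing q c) (diagonalCrossing q c))
    ≡⟨ cong (sideSign 1 q) (commonEnd-vertical-diagonal q c) ⟩
  sideSign 1 q (c , 1)
    ≡⟨ sideSign-top q (<⇒≤ c<q) ⟩
  Sign.+ ∎
  where open ≡-Reasoning

zigzag : ℕ → ℕ → ℕ → List Crossing
zigzag q c zero    = diagonal 1 q c ∷ []
zigzag q c (suc k) = diagonal 1 q c ∷ vertical 1 q c ∷ zigzag q (suc c) k

key-diagonal<key-vertical : ∀ {q c} → 0 < c → key (diagonal 1 q c) < key (vertical 1 q c)
key-diagonal<key-vertical {q} {suc a} _ = *-monoʳ-< (suc a * 1) (n<1+n q)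

key-vertical≤key-diagonal : ∀ {q c} → c ≤ q → key (vertical 1 q c) ≤ key (diagonal 1 q (suc c))
key-vertical≤key-diagonal {q} {c} c≤q with m≤n⇒∃[o]m+o≡n c≤q
... | r , refl = subst (c * 1 * (1 + (c + r)) ≤_) (ring c r) (m≤m+n _ r)
  where
  ring : ∀ c r → c * 1 * (1 + (c + r)) + r ≡ suc c * 1 * (c + r)
  ring = solve-∀

merge-zigzag : ∀ q c k → 0 < c → c + k ≤ q →
  merge (λ x y → key x ≤? key y)
        (map (vertical 1 q) (iterate suc c k)) (map (diagonal 1 q) (iterate suc c (suc k)))
    ≡ zigzag q c k
merge-zigzag q c zero    _   _ = refl
merge-zigzag q c (suc k) 0<c c+k≤q
  rewrite dec-false (key (vertical 1 q c) ≤? key (diagonal 1 q c)) (<⇒≱ (key-diagonal<key-vertical 0<c))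
        | dec-true (key (vertical 1 q c) ≤? key (diagonal 1 q (suc c)))
                   (key-vertical≤key-diagonal (≤-trans (m≤m+n c (suc k)) c+k≤q))
        | merge-zigzag q (suc c) k z<s (subst (_≤ q) (+-suc c k) c+k≤q) = refl

crossings-zigzag : ∀ q → crossings 1 (suc q) ≡ zigzag (suc q) 1 q
crossings-zigzag q = trans
  (cong₂ (merge (λ x y → key x ≤? key y))
         (map-shift-upTo (vertical 1 (suc q)) q) (map-shift-upTo (diagonal 1 (suc q)) (suc q)))
  (merge-zigzag (suc q) 1 q z<s ≤-refl)

-- Signs contributed by the c-th diagonal crossing, the corner (c,0), the c-th vertical
-- crossing and the corner (c,1), according as 2c < q, 2c = q or 2c > q.
lowBlock midBlock highBlock : List Sign
lowBlock  = Sign.- ∷ Sign.- ∷ Sign.- ∷ Sign.+ ∷ []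
midBlock  = Sign.- ∷ Sign.- ∷ Sign.+ ∷ Sign.+ ∷ []
highBlock = Sign.+ ∷ Sign.- ∷ Sign.+ ∷ Sign.+ ∷ []

module _ (q : ℕ) where

  body-zigzag : ∀ m c k → 0 < c → c < q → body 1 q m (zigzag q c (suc k)) ≡
    oddSign 1 q m (diagonal 1 q c) ∷ Sign.- ∷ oddSign 1 q m (vertical 1 q c) ∷ Sign.+ ∷ body 1 q m (zigzag q (suc c) k)
  body-zigzag m c k 0<c c<q = begin
    body 1 q m (zigzag q c (suc k))
      ≡⟨ unfold k ⟩
    oddSign 1 q m D ∷ evenSign 1 q D V ∷ oddSign 1 q m V ∷ evenSign 1 q V (diagonal 1 q (suc c)) ∷ body 1 q m (zigzag q (suc c) k)
      ≡⟨ cong₂ (λ s t → oddSign 1 q m D ∷ s ∷ oddSign 1 q m V ∷ t ∷ body 1 q m (zigzag q (suc c) k))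
               (evenSign-diagonal-vertical 0<c c<q) (evenSign-vertical-diagonal c<q) ⟩
    oddSign 1 q m D ∷ Sign.- ∷ oddSign 1 q m V ∷ Sign.+ ∷ body 1 q m (zigzag q (suc c) k) ∎
    where
    open ≡-Reasoning
    D V : Crossing
    D = diagonal 1 q c
    V = vertical 1 q c
    unfold : ∀ k → body 1 q m (zigzag q c (suc k)) ≡
      oddSign 1 q m D ∷ evenSign 1 q D V ∷ oddSign 1 q m V ∷ evenSign 1 q V (diagonal 1 q (suc c)) ∷ body 1 q m (zigzag q (suc c) k)
    unfold zero    = refl
    unfold (suc k) = refl

  body-zigzag-low : ∀ m j c k → 0 < c → (j + c) + (j + c) ≤ suc q →
    body 1 q m (zigzag q c (j + k)) ≡ concat (replicate j lowBlock) ++ body 1 q m (zigzag q (j + c) k)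
  body-zigzag-low m zero    c k _   _ = refl
  body-zigzag-low m (suc j) c k 0<c h = begin
    body 1 q m (zigzag q c (suc j + k))
      ≡⟨ body-zigzag m c (j + k) 0<c (≤-trans (s≤s (m≤m+n c c)) 2c<q) ⟩
    oddSign 1 q m (diagonal 1 q c) ∷ Sign.- ∷ oddSign 1 q m (vertical 1 q c) ∷ Sign.+ ∷ body 1 q m (zigzag q (suc c) (j + k))
      ≡⟨ cong₂ (λ s t → s ∷ Sign.- ∷ t ∷ Sign.+ ∷ body 1 q m (zigzag q (suc c) (j + k)))
               (oddSign-diagonal-low m 0<c (<⇒≤ 2c<q)) (oddSign-vertical-low m 0<c 2c<q) ⟩
    lowBlock ++ body 1 q m (zigzag q (suc c) (j + k))
      ≡⟨ cong (lowBlock ++_) (body-zigzag-low m j (suc c) k z<s (subst (λ n → n + n ≤ suc q) (sym (+-suc j c)) h)) ⟩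
    lowBlock ++ (concat (replicate j lowBlock) ++ body 1 q m (zigzag q (j + suc c) k))
      ≡⟨ cong (λ n → lowBlock ++ (concat (replicate j lowBlock) ++ body 1 q m (zigzag q n k))) (+-suc j c) ⟩
    concat (replicate (suc j) lowBlock) ++ body 1 q m (zigzag q (suc j + c) k) ∎
    where
    open ≡-Reasoning
    2c<q : c + c < q
    2c<q = ≤-trans (s≤s (+-mono-≤ (m≤n+m c j) (m≤n+m c j))) (subst (_≤ q) (+-suc (j + c) (j + c)) (≤-pred h))

  body-zigzag-high : ∀ j c k → q < c + c → j + c ≤ q →
    body 1 q Sign.+ (zigzag q c (j + k)) ≡ concat (replicate j highBlock) ++ body 1 q Sign.+ (zigzag q (j + c) k)
  body-zigzag-high zero    c       k _   _ = refl
  body-zigzag-high (suc j) zero    k () _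
  body-zigzag-high (suc j) c@(suc _) k q<2c h = begin
    body 1 q Sign.+ (zigzag q c (suc j + k))
      ≡⟨ body-zigzag Sign.+ c (j + k) z<s c<q ⟩
    oddSign 1 q Sign.+ (diagonal 1 q c) ∷ Sign.- ∷ oddSign 1 q Sign.+ (vertical 1 q c) ∷ Sign.+ ∷ body 1 q Sign.+ (zigzag q (suc c) (j + k))
      ≡⟨ cong₂ (λ s t → s ∷ Sign.- ∷ t ∷ Sign.+ ∷ body 1 q Sign.+ (zigzag q (suc c) (j + k)))
               (oddSign-diagonal-high z<s (<⇒≤ c<q) q<2c) (oddSign-vertical-high c<q (<⇒≤ q<2c)) ⟩
    highBlock ++ body 1 q Sign.+ (zigzag q (suc c) (j + k))
      ≡⟨ cong (highBlock ++_) (body-zigzag-high j (suc c) k (<-trans q<2c (+-mono-< (n<1+n c) (n<1+n c)))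
                                                          (subst (_≤ q) (sym (+-suc j c)) h)) ⟩
    highBlock ++ (concat (replicate j highBlock) ++ body 1 q Sign.+ (zigzag q (j + suc c) k))
      ≡⟨ cong (λ n → highBlock ++ (concat (replicate j highBlock) ++ body 1 q Sign.+ (zigzag q n k))) (+-suc j c) ⟩
    concat (replicate (suc j) highBlock) ++ body 1 q Sign.+ (zigzag q (suc j + c) k) ∎
    where
    open ≡-Reasoning
    c<q : c < q
    c<q = ≤-trans (s≤s (m≤n+m c j)) h

  body-zigzag-mid : ∀ c k → 0 < c → c + c ≡ q →
    body 1 q Sign.+ (zigzag q c (suc k)) ≡ midBlock ++ body 1 q Sign.+ (zigzag q (suc c) k)
  body-zigzag-mid c k 0<c refl = begin
    body 1 q Sign.+ (zigzag q c (suc k))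
      ≡⟨ body-zigzag Sign.+ c k 0<c c<q ⟩
    oddSign 1 q Sign.+ (diagonal 1 q c) ∷ Sign.- ∷ oddSign 1 q Sign.+ (vertical 1 q c) ∷ Sign.+ ∷ body 1 q Sign.+ (zigzag q (suc c) k)
      ≡⟨ cong₂ (λ s t → s ∷ Sign.- ∷ t ∷ Sign.+ ∷ body 1 q Sign.+ (zigzag q (suc c) k))
               (oddSign-diagonal-low Sign.+ 0<c ≤-refl) (oddSign-vertical-high c<q ≤-refl) ⟩
    midBlock ++ body 1 q Sign.+ (zigzag q (suc c) k) ∎
    where
    open ≡-Reasoning
    c<q : c < c + c
    c<q = m<m+n c 0<c

body-zigzag-last : ∀ q → 0 < q → body 1 q Sign.+ (zigzag q q 0) ≡ Sign.+ ∷ []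
body-zigzag-last q 0<q = cong (_∷ []) (oddSign-diagonal-high 0<q ≤-refl (m<m+n q 0<q))

runsFrom-lowBlocks : ∀ j rest → runsFrom Sign.+ 1 (concat (replicate j lowBlock) ++ rest)
                              ≡ concat (replicate j (1 ∷ 3 ∷ [])) ++ runsFrom Sign.+ 1 rest
runsFrom-lowBlocks zero    rest = refl
runsFrom-lowBlocks (suc j) rest = cong (λ ns → 1 ∷ 3 ∷ ns) (runsFrom-lowBlocks j rest)

runsFrom-highBlocks : ∀ j rest → runsFrom Sign.+ 2 (concat (replicate j highBlock) ++ rest)
                               ≡ concat (replicate j (3 ∷ 1 ∷ [])) ++ runsFrom Sign.+ 2 rest
runsFrom-highBlocks zero    rest = refl
runsFrom-highBlocks (suc j) rest = cong (λ ns → 3 ∷ 1 ∷ ns) (runsFrom-highBlocks j rest)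

signSeq-body : ∀ {q m} xs ys → body 1 q m (crossings 1 q) ≡ xs ++ ys ++ Sign.+ ∷ [] →
  signSeq 1 q m ≡ Sign.- ∷ xs ++ ys ++ Sign.+ ∷ Sign.+ ∷ []
signSeq-body xs ys h = cong (Sign.- ∷_) (begin
  _ ++ [+]               ≡⟨ cong (_++ [+]) h ⟩
  (xs ++ ys ++ [+]) ++ [+] ≡⟨ ++-assoc xs (ys ++ [+]) [+] ⟩
  xs ++ (ys ++ [+]) ++ [+] ≡⟨ cong (xs ++_) (++-assoc ys [+] [+]) ⟩
  xs ++ ys ++ [+] ++ [+] ∎)
  where
  open ≡-Reasoning
  [+] : List Sign
  [+] = Sign.+ ∷ []

body-odd : ∀ j → body 1 (3 + j * 2) Sign.+ (crossings 1 (3 + j * 2))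
  ≡ concat (replicate (suc j) lowBlock) ++ concat (replicate (suc j) highBlock) ++ Sign.+ ∷ []
body-odd j = begin
  body 1 q Sign.+ (crossings 1 q)
    ≡⟨ cong (body 1 q Sign.+) (trans (crossings-zigzag (2 + j * 2)) (cong (zigzag q 1) (count j))) ⟩
  body 1 q Sign.+ (zigzag q 1 (suc j + (suc j + 0)))
    ≡⟨ body-zigzag-low q Sign.+ (suc j) 1 (suc j + 0) z<s (≤-reflexive (low j)) ⟩
  lows ++ body 1 q Sign.+ (zigzag q (suc j + 1) (suc j + 0))
    ≡⟨ cong (lows ++_) (body-zigzag-high q (suc j) (suc j + 1) 0 (≤-reflexive (high j)) (≤-reflexive (top j))) ⟩
  lows ++ highs ++ body 1 q Sign.+ (zigzag q (suc j + (suc j + 1)) 0)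
    ≡⟨ cong (λ c → lows ++ highs ++ body 1 q Sign.+ (zigzag q c 0)) (top j) ⟩
  lows ++ highs ++ body 1 q Sign.+ (zigzag q q 0)
    ≡⟨ cong (λ b → lows ++ highs ++ b) (body-zigzag-last q z<s) ⟩
  lows ++ highs ++ Sign.+ ∷ [] ∎
  where
  open ≡-Reasoning
  q : ℕ
  q = 3 + j * 2
  lows highs : List Sign
  lows = concat (replicate (suc j) lowBlock)
  highs = concat (replicate (suc j) highBlock)
  count : ∀ j → 2 + j * 2 ≡ suc j + (suc j + 0)
  count = solve-∀
  low : ∀ j → (suc j + 1) + (suc j + 1) ≡ suc (3 + j * 2)
  low = solve-∀
  high : ∀ j → suc (3 + j * 2) ≡ (suc j + 1) + (suc j + 1)
  high = solve-∀
  top : ∀ j → suc j + (suc j + 1) ≡ 3 + j * 2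
  top = solve-∀

body-even : ∀ j → body 1 (4 + j * 2) Sign.+ (crossings 1 (4 + j * 2))
  ≡ concat (replicate (suc j) lowBlock) ++ midBlock ++ concat (replicate (suc j) highBlock) ++ Sign.+ ∷ []
body-even j = begin
  body 1 q Sign.+ (crossings 1 q)
    ≡⟨ cong (body 1 q Sign.+) (trans (crossings-zigzag (3 + j * 2)) (cong (zigzag q 1) (count j))) ⟩
  body 1 q Sign.+ (zigzag q 1 (suc j + suc (suc j + 0)))
    ≡⟨ body-zigzag-low q Sign.+ (suc j) 1 (suc (suc j + 0)) z<s (≤-trans (≤-reflexive (mid j)) (n≤1+n q)) ⟩
  lows ++ body 1 q Sign.+ (zigzag q (suc j + 1) (suc (suc j + 0)))
    ≡⟨ cong (lows ++_) (body-zigzag-mid q (suc j + 1) (suc j + 0) z<s (mid j)) ⟩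
  lows ++ midBlock ++ body 1 q Sign.+ (zigzag q (suc (suc j + 1)) (suc j + 0))
    ≡⟨ cong (λ b → lows ++ midBlock ++ b)
            (body-zigzag-high q (suc j) (suc (suc j + 1)) 0 (≤-trans (n≤1+n (suc q)) (≤-reflexive (high j))) (≤-reflexive (top j))) ⟩
  lows ++ midBlock ++ highs ++ body 1 q Sign.+ (zigzag q (suc j + suc (suc j + 1)) 0)
    ≡⟨ cong (λ c → lows ++ midBlock ++ highs ++ body 1 q Sign.+ (zigzag q c 0)) (top j) ⟩
  lows ++ midBlock ++ highs ++ body 1 q Sign.+ (zigzag q q 0)
    ≡⟨ cong (λ b → lows ++ midBlock ++ highs ++ b) (body-zigzag-last q z<s) ⟩
  lows ++ midBlock ++ highs ++ Sign.+ ∷ [] ∎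
  where
  open ≡-Reasoning
  q : ℕ
  q = 4 + j * 2
  lows highs : List Sign
  lows = concat (replicate (suc j) lowBlock)
  highs = concat (replicate (suc j) highBlock)
  count : ∀ j → 3 + j * 2 ≡ suc j + suc (suc j + 0)
  count = solve-∀
  mid : ∀ j → (suc j + 1) + (suc j + 1) ≡ 4 + j * 2
  mid = solve-∀
  high : ∀ j → 6 + j * 2 ≡ suc (suc j + 1) + suc (suc j + 1)
  high = solve-∀
  top : ∀ j → suc j + suc (suc j + 1) ≡ 4 + j * 2
  top = solve-∀

oddRuns evenRuns : ℕ → List ℕ
oddRuns j  = 4 ∷ concat (replicate j (1 ∷ 3 ∷ [])) ++ (2 ∷ 1 ∷ concat (replicate j (3 ∷ 1 ∷ [])) ++ (4 ∷ []))
evenRuns j = 4 ∷ concat (replicate j (1 ∷ 3 ∷ [])) ++ (1 ∷ 2 ∷ 3 ∷ 1 ∷ concat (replicate j (3 ∷ 1 ∷ [])) ++ (4 ∷ []))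

C-odd : ∀ j → C 1 (3 + j * 2) Sign.+ ≡ oddRuns j
C-odd j = begin
  runs (signSeq 1 (3 + j * 2) Sign.+)
    ≡⟨ cong runs (signSeq-body lows highs (body-odd j)) ⟩
  4 ∷ runsFrom Sign.+ 1 (concat (replicate j lowBlock) ++ highs ++ Sign.+ ∷ Sign.+ ∷ [])
    ≡⟨ cong (4 ∷_) (runsFrom-lowBlocks j _) ⟩
  4 ∷ concat (replicate j (1 ∷ 3 ∷ [])) ++ 2 ∷ 1 ∷ runsFrom Sign.+ 2 (concat (replicate j highBlock) ++ Sign.+ ∷ Sign.+ ∷ [])
    ≡⟨ cong (λ ns → 4 ∷ concat (replicate j (1 ∷ 3 ∷ [])) ++ 2 ∷ 1 ∷ ns) (runsFrom-highBlocks j _) ⟩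
  4 ∷ concat (replicate j (1 ∷ 3 ∷ [])) ++ 2 ∷ 1 ∷ concat (replicate j (3 ∷ 1 ∷ [])) ++ 4 ∷ [] ∎
  where
  open ≡-Reasoning
  lows highs : List Sign
  lows = concat (replicate (suc j) lowBlock)
  highs = concat (replicate (suc j) highBlock)

C-even : ∀ j → C 1 (4 + j * 2) Sign.+ ≡ evenRuns j
C-even j = begin
  runs (signSeq 1 (4 + j * 2) Sign.+)
    ≡⟨ cong runs (signSeq-body lows (midBlock ++ highs) (body-even j)) ⟩
  4 ∷ runsFrom Sign.+ 1 (concat (replicate j lowBlock) ++ midBlock ++ highs ++ Sign.+ ∷ Sign.+ ∷ [])
    ≡⟨ cong (4 ∷_) (runsFrom-lowBlocks j _) ⟩
  4 ∷ concat (replicate j (1 ∷ 3 ∷ [])) ++ 1 ∷ 2 ∷ 3 ∷ 1 ∷ runsFrom Sign.+ 2 (concat (replicate j highBlock) ++ Sign.+ ∷ Sign.+ ∷ [])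
    ≡⟨ cong (λ ns → 4 ∷ concat (replicate j (1 ∷ 3 ∷ [])) ++ 1 ∷ 2 ∷ 3 ∷ 1 ∷ ns) (runsFrom-highBlocks j _) ⟩
  4 ∷ concat (replicate j (1 ∷ 3 ∷ [])) ++ 1 ∷ 2 ∷ 3 ∷ 1 ∷ concat (replicate j (3 ∷ 1 ∷ [])) ++ 4 ∷ [] ∎
  where
  open ≡-Reasoning
  lows highs : List Sign
  lows = concat (replicate (suc j) lowBlock)
  highs = concat (replicate (suc j) highBlock)

lemma4p5 : (q : ℕ) → 3 ≤ q →
    (q % 2 ≡ 1 → ∃ λ m → C 1 q m ≡
        4 ∷ concat (replicate ((q ∸ 3) / 2) (1 ∷ 3 ∷ []))
          ++ (2 ∷ 1 ∷ concat (replicate ((q ∸ 3) / 2) (3 ∷ 1 ∷ [])) ++ (4 ∷ [])))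
    × (q % 2 ≡ 0 → ∃ λ m → C 1 q m ≡
        4 ∷ concat (replicate ((q ∸ 4) / 2) (1 ∷ 3 ∷ []))
          ++ (1 ∷ 2 ∷ 3 ∷ 1 ∷ concat (replicate ((q ∸ 4) / 2) (3 ∷ 1 ∷ [])) ++ (4 ∷ [])))
lemma4p5 q 3≤q with m≤n⇒∃[o]m+o≡n 3≤q
... | n , refl with even⊎odd n
... | inj₁ (j , refl) =
    (λ _ → Sign.+ , trans (C-odd j) (cong oddRuns (sym (m*n/n≡m j 2))))
  , (λ q%2≡0 → contradiction (trans (sym ([m+kn]%n≡m%n 3 j 2)) q%2≡0) λ ())
... | inj₂ (j , refl) =
    (λ q%2≡1 → contradiction (trans (sym ([m+kn]%n≡m%n 4 j 2)) q%2≡1) λ ())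
  , (λ _ → Sign.+ , trans (C-even j) (cong evenRuns (sym (m*n/n≡m j 2))))
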